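{- A Boolean relation $R\subseteq\{0,1\}^2$ of arity $2$ is balanced if and only if it is not cone-interdefinable with the $2$-OR relation.
   Context: A partial Boolean operation $f$ of arity $\ell$ is balanced if there are integers $\alpha_1,\ldots,\alpha_\ell$ with $\sum\alpha_i=1$ such that its domain is exactly the tuples with $\sum\alpha_ix_i\in\{0,1\}$, on which $f(x)=\sum\alpha_ix_i$. $f$ preserves $T\subseteq\{0,1\}^m$ if for all $t^1,\ldots,t^\ell\in T$, whenever the coordinatewise application of $f$ is defined in every coordinate, the result lies in $T$; a relation is balanced if preserved by all balanced operations. The $2$-OR relation is $\{(0,1),(1,0),(1,1)\}$. A relation $T$ of arity $m$ is cone-definable from a relation $U$ of arity $n$ if there is a tuple $(y_1,\ldots,y_n)$ with each $y_j\in\{0,1\}\cup\{x_1,\ldots,x_m\}\cup\{\neg x_1,\ldots,\neg x_m\}$, every $x_i$ occurs (as $x_i$ or $\neg x_i$) among the $y_j$, and for each $f\colon\{x_1,\ldots,x_m\}\to\{0,1\}$: $(f(x_1),\ldots,f(x_m))\in T$ iff $(\hat f(y_1),\ldots,\hat f(y_n))\in U$, where $\hat f(0)=0$, $\hat f(1)=1$, $\hat f(x_i)=f(x_i)$, $\hat f(\neg x_i)=\neg f(x_i)$. Two relations are cone-interdefinable if each is cone-definable from the other. -}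

module Defs where

open import Data.Nat using (ℕ; zero; suc)
open import Data.Integer using (ℤ; +_; _+_; _*_)
open import Data.Bool using (Bool; true; false; not; _∨_; if_then_else_)
open import Data.Fin using (Fin; zero; suc)
open import Data.Vec using (Vec; []; _∷_; lookup; tabulate; map)
open import Data.Empty using (⊥)
open import Data.Maybe using (Maybe; just; nothing)
open import Data.Product using (Σ; ∃; _×_; _,_)
open import Relation.Binary.PropositionalEquality using (_≡_)

-- A Boolean relation of arity m: a subset of {0,1}^m, given by its
-- characteristic function (tuples are vectors of Booleans; false = 0, true = 1).
BRel : ℕ → Set
BRel m = Vec Bool m → Bool

⟦_⟧ : Bool → ℤ
⟦ false ⟧ = + 0
⟦ true ⟧ = + 1

sumℤ : {ℓ : ℕ} → (Fin ℓ → ℤ) → ℤ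
sumℤ {zero} f = + 0
sumℤ {suc ℓ} f = f zero + sumℤ (λ i → f (suc i))

weighted : {ℓ : ℕ} → (Fin ℓ → ℤ) → (Fin ℓ → Bool) → ℤ
weighted α x = sumℤ (λ i → α i * ⟦ x i ⟧)

toBool? : ℤ → Maybe Bool
toBool? (+ 0) = just false
toBool? (+ 1) = just true
toBool? _ = nothing

balancedOp : {ℓ : ℕ} → (Fin ℓ → ℤ) → (Fin ℓ → Bool) → Maybe Bool
balancedOp α x = toBool? (weighted α x)

Preserves : {ℓ m : ℕ} → ((Fin ℓ → Bool) → Maybe Bool) → BRel m → Set
Preserves {ℓ} {m} g T =
  (t : Fin ℓ → Vec Bool m) → (∀ i → T (t i) ≡ true) →
  (r : Vec Bool m) → (∀ j → g (λ i → lookup (t i) j) ≡ just (lookup r j)) →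
  T r ≡ true

Balanced : {m : ℕ} → BRel m → Set
Balanced T = (ℓ : ℕ) (α : Fin ℓ → ℤ) → sumℤ α ≡ + 1 → Preserves (balancedOp α) T

OR2 : BRel 2
OR2 (a ∷ b ∷ []) = a ∨ b

data Lit (m : ℕ) : Set where
  const : Bool → Lit m
  pos   : Fin m → Lit m
  neg   : Fin m → Lit m

Occurs : {m : ℕ} → Fin m → Lit m → Set
Occurs i (const _) = ⊥
Occurs i (pos k) = k ≡ i
Occurs i (neg k) = k ≡ i

evalLit : {m : ℕ} → (Fin m → Bool) → Lit m → Bool
evalLit f (const b) = b
evalLit f (pos i) = f i
evalLit f (neg i) = not (f i)

ConeDefinable : {m n : ℕ} → BRel m → BRel n → Set
ConeDefinable {m} {n} T U =
  Σ (Vec (Lit m) n) λ y →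
    (∀ (i : Fin m) → ∃ λ (j : Fin n) → Occurs i (lookup y j)) ×
    (∀ (f : Fin m → Bool) → T (tabulate f) ≡ U (map (evalLit f) y))
    -- equality of Booleans = "(f(x₁),…,f(x_m)) ∈ T iff (f̂(y₁),…,f̂(y_n)) ∈ U"

ConeInterdefinable : {m n : ℕ} → BRel m → BRel n → Set
ConeInterdefinable T U = ConeDefinable T U × ConeDefinable U T

module Submission where

-- Both sides single out the same four relations: the
-- "punctured squares" {0,1}² ∖ {q}, i.e. the relations x₀ ⊕ q₀ ∨ x₁ ⊕ q₁.
--
-- 1. Column arithmetic.  For Σ αᵢ = 1 the balanced operation maps a constant
--    column b to b, and complementary columns to complementary values.
--    Hence every affine constraint "xⱼ = b" or "xₖ = xⱼ ⊕ b" (in any arity)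
--    is balanced, and so is every conjunction of such constraints.
-- 2. Punctured squares.  q is the combination t₀ − t₁ + t₂ of three members
--    of {0,1}² ∖ {q}, so the punctured square is not balanced; it is
--    cone-interdefinable with 2-OR via the literals xᵢ ⊕ qᵢ; and conversely
--    anything cone-definable from 2-OR (with both variables occurring) is a
--    punctured square.
-- 3. Dichotomy.  By inspecting the 16 binary relations, each one is either a
--    punctured square or the conjunction of the affine constraints it
--    satisfies.

open import Defs
open import Function.Base using (_∘_)
open import Function.Bundles using (_⇔_; mk⇔)
open import Relation.Nullary using (¬_)
open import Data.Nat using (ℕ; zero; suc)
open import Data.Integer using (ℤ; +_; -[1+_]; _+_; _*_)
import Data.Integer.Properties as ℤ
open import Algebra.Properties.Semiring.Sum ℤ.+-*-semiring
  using (sum; sum-cong-≗; ∑-distrib-+; *-distribʳ-sum)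
open import Data.Bool using (Bool; true; false; not; _∧_; _∨_; _xor_)
open import Data.Bool.Properties
  using (∨-comm; ∨-zeroʳ; xor-same; xor-comm; xor-assoc; xor-identityʳ; xor-inverseˡ)
open import Data.Fin using (Fin; zero; suc)
open import Data.Vec using (Vec; []; _∷_; lookup; tabulate; map)
open import Data.Vec.Properties using (tabulate∘lookup)
open import Data.List using (List; []; _∷_; filterᵇ)
open import Data.Bool.ListAction using (all)
open import Data.Empty using (⊥-elim)
open import Data.Maybe using (just)
open import Data.Maybe.Properties using (just-injective)
open import Data.Product using (∃; ∃₂; _×_; _,_; proj₁; proj₂)
open import Data.Sum using (_⊎_; inj₁; inj₂)
open import Relation.Binary.PropositionalEquality

balanced-resp : {m : ℕ} {R S : BRel m} → R ≗ S → Balanced R → Balanced S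
balanced-resp R≗S bal ℓ α Σα t t∈S r hr =
  trans (sym (R≗S r)) (bal ℓ α Σα t (λ i → trans (R≗S (t i)) (t∈S i)) r hr)

interdefinable-resp : {m n : ℕ} {R S : BRel m} {U : BRel n} →
  R ≗ S → ConeInterdefinable R U → ConeInterdefinable S U
interdefinable-resp R≗S ((y , occ , R-def) , (y′ , occ′ , U-def)) =
  (y , occ , λ f → trans (sym (R≗S (tabulate f))) (R-def f)) ,
  (y′ , occ′ , λ f → trans (U-def f) (R≗S _))

≗-from-tabulate : {m : ℕ} {R S : BRel m} →
  (∀ f → R (tabulate f) ≡ S (tabulate f)) → R ≗ S
≗-from-tabulate {R = R} {S} eq v =
  subst (λ w → R w ≡ S w) (tabulate∘lookup v) (eq (lookup v))

-- 1. Column arithmetic of balanced operations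

sumℤ≡sum : {ℓ : ℕ} (f : Fin ℓ → ℤ) → sumℤ f ≡ sum f
sumℤ≡sum {zero} f = refl
sumℤ≡sum {suc ℓ} f = cong (λ s → f zero + s) (sumℤ≡sum (f ∘ suc))

weighted-≗ : {ℓ : ℕ} (α : Fin ℓ → ℤ) {x y : Fin ℓ → Bool} →
  (∀ i → x i ≡ y i) → weighted α x ≡ weighted α y
weighted-≗ α {x} {y} x≗y = begin
  weighted α x                ≡⟨ sumℤ≡sum (λ i → α i * ⟦ x i ⟧) ⟩
  sum (λ i → α i * ⟦ x i ⟧)  ≡⟨ sum-cong-≗ (λ i → cong (λ b → α i * ⟦ b ⟧) (x≗y i)) ⟩
  sum (λ i → α i * ⟦ y i ⟧)  ≡⟨ sumℤ≡sum (λ i → α i * ⟦ y i ⟧) ⟨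
  weighted α y                ∎
  where open ≡-Reasoning

weighted-constant : {ℓ : ℕ} (α : Fin ℓ → ℤ) → sumℤ α ≡ + 1 →
  (b : Bool) → weighted α (λ _ → b) ≡ ⟦ b ⟧
weighted-constant α Σα b = begin
  weighted α (λ _ → b) ≡⟨ sumℤ≡sum (λ i → α i * ⟦ b ⟧) ⟩
  sum (λ i → α i * ⟦ b ⟧) ≡⟨ *-distribʳ-sum ⟦ b ⟧ α ⟨
  sum α * ⟦ b ⟧        ≡⟨ cong (_* ⟦ b ⟧) (trans (sym (sumℤ≡sum α)) Σα) ⟩
  + 1 * ⟦ b ⟧          ≡⟨ ℤ.*-identityˡ ⟦ b ⟧ ⟩
  ⟦ b ⟧                ∎
  where open ≡-Reasoning

weighted-complement : {ℓ : ℕ} (α : Fin ℓ → ℤ) → sumℤ α ≡ + 1 →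
  (x : Fin ℓ → Bool) → weighted α (not ∘ x) + weighted α x ≡ + 1
weighted-complement α Σα x = begin
  weighted α (not ∘ x) + weighted α x
    ≡⟨ cong₂ _+_ (sumℤ≡sum (λ i → α i * ⟦ not (x i) ⟧)) (sumℤ≡sum (λ i → α i * ⟦ x i ⟧)) ⟩
  sum (λ i → α i * ⟦ not (x i) ⟧) + sum (λ i → α i * ⟦ x i ⟧)
    ≡⟨ ∑-distrib-+ (λ i → α i * ⟦ not (x i) ⟧) (λ i → α i * ⟦ x i ⟧) ⟨
  sum (λ i → α i * ⟦ not (x i) ⟧ + α i * ⟦ x i ⟧)
    ≡⟨ sum-cong-≗ (λ i → split (α i) (x i)) ⟩
  sum α
    ≡⟨ sumℤ≡sum α ⟨
  sumℤ α
    ≡⟨ Σα ⟩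
  + 1 ∎
  where
  open ≡-Reasoning
  split : ∀ a b → a * ⟦ not b ⟧ + a * ⟦ b ⟧ ≡ a
  split a false = trans (cong₂ _+_ (ℤ.*-identityʳ a) (ℤ.*-zeroʳ a)) (ℤ.+-identityʳ a)
  split a true = trans (cong₂ _+_ (ℤ.*-zeroʳ a) (ℤ.*-identityʳ a)) (ℤ.+-identityˡ a)

toBool?-sound : ∀ w {b} → toBool? w ≡ just b → w ≡ ⟦ b ⟧
toBool?-sound (+ 0) refl = refl
toBool?-sound (+ 1) refl = refl
toBool?-sound (+ suc (suc n)) ()
toBool?-sound -[1+ n ] ()

⟦⟧-injective : ∀ {a b} → ⟦ a ⟧ ≡ ⟦ b ⟧ → a ≡ b
⟦⟧-injective {false} {false} _ = refl
⟦⟧-injective {true} {true} _ = refl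

⟦⟧-complementary : ∀ a b → ⟦ a ⟧ + ⟦ b ⟧ ≡ + 1 → a ≡ not b
⟦⟧-complementary false true _ = refl
⟦⟧-complementary true false _ = refl

constant-column : {ℓ : ℕ} (α : Fin ℓ → ℤ) → sumℤ α ≡ + 1 →
  {x : Fin ℓ → Bool} {b r : Bool} →
  (∀ i → x i ≡ b) → balancedOp α x ≡ just r → r ≡ b
constant-column α Σα {x} {b} x≗b x↦r = ⟦⟧-injective (begin
  ⟦ _ ⟧                 ≡⟨ toBool?-sound (weighted α x) x↦r ⟨
  weighted α x          ≡⟨ weighted-≗ α x≗b ⟩
  weighted α (λ _ → b)  ≡⟨ weighted-constant α Σα b ⟩
  ⟦ b ⟧                 ∎)
  where open ≡-Reasoning

shifted-column : {ℓ : ℕ} (α : Fin ℓ → ℤ) → sumℤ α ≡ + 1 →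
  {x y : Fin ℓ → Bool} {b r s : Bool} → (∀ i → y i ≡ x i xor b) →
  balancedOp α x ≡ just r → balancedOp α y ≡ just s → s ≡ r xor b
shifted-column α Σα {x} {y} {false} {r} y≗x x↦r y↦s =
  trans (just-injective (trans (sym y↦s) (trans (cong toBool? same) x↦r)))
        (sym (xor-identityʳ r))
  where
  same : weighted α y ≡ weighted α x
  same = weighted-≗ α (λ i → trans (y≗x i) (xor-identityʳ (x i)))
shifted-column α Σα {x} {y} {true} {r} {s} y≗¬x x↦r y↦s =
  trans (⟦⟧-complementary s r (begin
    ⟦ s ⟧ + ⟦ r ⟧ ≡⟨ cong₂ _+_ (toBool?-sound _ y↦s) (toBool?-sound _ x↦r) ⟨
    weighted α y + weighted α x
      ≡⟨ cong (_+ weighted α x) (weighted-≗ α (λ i → trans (y≗¬x i) (xor-true (x i)))) ⟩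
    weighted α (not ∘ x) + weighted α x ≡⟨ weighted-complement α Σα x ⟩
    + 1 ∎))
  (sym (xor-true r))
  where
  open ≡-Reasoning
  xor-true : ∀ a → a xor true ≡ not a
  xor-true a = xor-comm a true

data Constraint (m : ℕ) : Set where
  fix  : Fin m → Bool → Constraint m
  link : Fin m → Fin m → Bool → Constraint m

_==_ : Bool → Bool → Bool
false == b = not b
true == b = b

==-sound : ∀ {a b} → (a == b) ≡ true → a ≡ b
==-sound {false} {false} _ = refl
==-sound {true} {true} _ = refl

==-refl : ∀ {a b} → a ≡ b → (a == b) ≡ true
==-refl {false} refl = refl
==-refl {true} refl = refl

holds : {m : ℕ} → Constraint m → BRel m
holds (fix j b) v = lookup v j == b
holds (link j k b) v = lookup v k == (lookup v j xor b)

constraint-balanced : {m : ℕ} (c : Constraint m) → Balanced (holds c)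
constraint-balanced (fix j b) ℓ α Σα t t∈c r hr =
  ==-refl (constant-column α Σα (λ i → ==-sound (t∈c i)) (hr j))
constraint-balanced (link j k b) ℓ α Σα t t∈c r hr =
  ==-refl (shifted-column α Σα (λ i → ==-sound (t∈c i)) (hr j) (hr k))

_∩_ : {m : ℕ} → BRel m → BRel m → BRel m
(R ∩ S) v = R v ∧ S v

∧-true : ∀ {a b} → a ∧ b ≡ true → a ≡ true × b ≡ true
∧-true {true} {true} _ = refl , refl

∩-balanced : {m : ℕ} {R S : BRel m} → Balanced R → Balanced S → Balanced (R ∩ S)
∩-balanced balR balS ℓ α Σα t t∈R∩S r hr =
  cong₂ _∧_ (balR ℓ α Σα t (proj₁ ∘ ∧-true ∘ t∈R∩S) r hr)
            (balS ℓ α Σα t (proj₂ ∘ ∧-true ∘ t∈R∩S) r hr)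

solutions : {m : ℕ} → List (Constraint m) → BRel m
solutions [] _ = true
solutions (c ∷ cs) = holds c ∩ solutions cs

solutions-balanced : {m : ℕ} (cs : List (Constraint m)) → Balanced (solutions cs)
solutions-balanced [] ℓ α Σα t _ r _ = refl
solutions-balanced (c ∷ cs) =
  ∩-balanced {R = holds c} (constraint-balanced c) (solutions-balanced cs)

-- 2. Punctured squares

punctured : Bool → Bool → BRel 2
punctured q₀ q₁ (x₀ ∷ x₁ ∷ []) = (x₀ xor q₀) ∨ (x₁ xor q₁)

punctured-misses : ∀ q₀ q₁ → punctured q₀ q₁ (q₀ ∷ q₁ ∷ []) ≡ false
punctured-misses q₀ q₁ rewrite xor-same q₀ | xor-same q₁ = refl

punctured-∋ˡ : ∀ q₀ q₁ x₁ → punctured q₀ q₁ (not q₀ ∷ x₁ ∷ []) ≡ true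
punctured-∋ˡ q₀ q₁ x₁ rewrite xor-inverseˡ q₀ = refl

punctured-∋ʳ : ∀ q₀ q₁ x₀ → punctured q₀ q₁ (x₀ ∷ not q₁ ∷ []) ≡ true
punctured-∋ʳ q₀ q₁ x₀ rewrite xor-inverseˡ q₁ = ∨-zeroʳ (x₀ xor q₀)

-- The affine combination t₀ − t₁ + t₂ ...
alternating : Fin 3 → ℤ
alternating zero = + 1
alternating (suc zero) = -[1+ 0 ]
alternating (suc (suc zero)) = + 1

-- ... of these three members of the punctured square ...
corners : Bool → Bool → Fin 3 → Vec Bool 2
corners q₀ q₁ zero = q₀ ∷ not q₁ ∷ []
corners q₀ q₁ (suc zero) = not q₀ ∷ not q₁ ∷ []
corners q₀ q₁ (suc (suc zero)) = not q₀ ∷ q₁ ∷ []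

corners-members : ∀ q₀ q₁ i → punctured q₀ q₁ (corners q₀ q₁ i) ≡ true
corners-members q₀ q₁ zero = punctured-∋ʳ q₀ q₁ q₀
corners-members q₀ q₁ (suc zero) = punctured-∋ˡ q₀ q₁ (not q₁)
corners-members q₀ q₁ (suc (suc zero)) = punctured-∋ˡ q₀ q₁ q₁

-- ... is the missing point.
corners-combine : ∀ q₀ q₁ j →
  balancedOp alternating (λ i → lookup (corners q₀ q₁ i) j) ≡ just (lookup (q₀ ∷ q₁ ∷ []) j)
corners-combine false q₁ zero = refl
corners-combine true q₁ zero = refl
corners-combine q₀ false (suc zero) = refl
corners-combine q₀ true (suc zero) = refl

punctured-not-balanced : ∀ q₀ q₁ → ¬ Balanced (punctured q₀ q₁)
punctured-not-balanced q₀ q₁ bal with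
  trans (sym (punctured-misses q₀ q₁))
        (bal 3 alternating refl (corners q₀ q₁) (corners-members q₀ q₁)
             (q₀ ∷ q₁ ∷ []) (corners-combine q₀ q₁))
... | ()

lit : {m : ℕ} → Bool → Fin m → Lit m
lit false = pos
lit true = neg

evalLit-lit : {m : ℕ} (f : Fin m → Bool) (q : Bool) (i : Fin m) → evalLit f (lit q i) ≡ f i xor q
evalLit-lit f false i = sym (xor-identityʳ (f i))
evalLit-lit f true i = sym (xor-comm (f i) true)

xor-cancelʳ : ∀ a q → (a xor q) xor q ≡ a
xor-cancelʳ a q = trans (xor-assoc a q q) (trans (cong (a xor_) (xor-same q)) (xor-identityʳ a))

punctured-interdefinable : ∀ q₀ q₁ → ConeInterdefinable (punctured q₀ q₁) OR2
punctured-interdefinable q₀ q₁ = (y , occurs , P-def) , (y , occurs , OR-def)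
  where
  y : Vec (Lit 2) 2
  y = lit q₀ zero ∷ lit q₁ (suc zero) ∷ []
  lit-occurs : ∀ q (i : Fin 2) → Occurs i (lit q i)
  lit-occurs false i = refl
  lit-occurs true i = refl
  occurs : ∀ (i : Fin 2) → ∃ λ (j : Fin 2) → Occurs i (lookup y j)
  occurs zero = zero , lit-occurs q₀ zero
  occurs (suc zero) = suc zero , lit-occurs q₁ (suc zero)
  P-def : ∀ f → punctured q₀ q₁ (tabulate f) ≡ OR2 (map (evalLit f) y)
  P-def f = sym (cong₂ _∨_ (evalLit-lit f q₀ zero) (evalLit-lit f q₁ (suc zero)))
  OR-def : ∀ f → OR2 (tabulate f) ≡ punctured q₀ q₁ (map (evalLit f) y)
  OR-def f rewrite evalLit-lit f q₀ zero | evalLit-lit f q₁ (suc zero)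
                 | xor-cancelʳ (f zero) q₀ | xor-cancelʳ (f (suc zero)) q₁ = refl

polarity : {m : ℕ} → Lit m → Bool
polarity (const _) = false
polarity (pos _) = false
polarity (neg _) = true

evalLit-occurs : {m : ℕ} (f : Fin m → Bool) {i : Fin m} (l : Lit m) →
  Occurs i l → evalLit f l ≡ f i xor polarity l
evalLit-occurs f (pos i) refl = sym (xor-identityʳ (f i))
evalLit-occurs f (neg i) refl = sym (xor-comm (f i) true)

occurs-unique : {m : ℕ} {i k : Fin m} (l : Lit m) → Occurs i l → Occurs k l → i ≡ k
occurs-unique (pos _) refl refl = refl
occurs-unique (neg _) refl refl = refl

-- Both variables must occur among the two literals, so a binary relation
-- cone-definable from 2-OR is an OR of two literals on distinct variables.
definable-from-OR2 : {R : BRel 2} → ConeDefinable R OR2 →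
  ∃₂ λ q₀ q₁ → R ≗ punctured q₀ q₁
definable-from-OR2 (l₀ ∷ l₁ ∷ [] , occurs , R-def) with occurs zero | occurs (suc zero)
... | zero , o₀ | zero , o₁ with () ← occurs-unique l₀ o₀ o₁
... | suc zero , o₀ | suc zero , o₁ with () ← occurs-unique l₁ o₀ o₁
... | zero , o₀ | suc zero , o₁ =
  polarity l₀ , polarity l₁ , ≗-from-tabulate λ f →
    trans (R-def f) (cong₂ _∨_ (evalLit-occurs f l₀ o₀) (evalLit-occurs f l₁ o₁))
... | suc zero , o₀ | zero , o₁ =
  polarity l₁ , polarity l₀ , ≗-from-tabulate λ f →
    trans (R-def f) (trans (cong₂ _∨_ (evalLit-occurs f l₀ o₁) (evalLit-occurs f l₁ o₀))
                           (∨-comm (f (suc zero) xor polarity l₀) (f zero xor polarity l₁)))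

-- 3. Every binary relation is a punctured square or affine

binaryConstraints : List (Constraint 2)
binaryConstraints =
  fix zero false ∷ fix zero true ∷ fix (suc zero) false ∷ fix (suc zero) true ∷
  link zero (suc zero) false ∷ link zero (suc zero) true ∷ []

squarePoints : List (Vec Bool 2)
squarePoints =
  (false ∷ false ∷ []) ∷ (false ∷ true ∷ []) ∷ (true ∷ false ∷ []) ∷ (true ∷ true ∷ []) ∷ []

supportedConstraints : BRel 2 → List (Constraint 2)
supportedConstraints R = filterᵇ supports binaryConstraints
  where
  supports : Constraint 2 → Bool
  supports c = all (λ v → not (R v) ∨ holds c v) squarePoints

affineHull : BRel 2 → BRel 2
affineHull R = solutions (supportedConstraints R)

affineHull-balanced : (R : BRel 2) → Balanced (affineHull R)
affineHull-balanced R = solutions-balanced (supportedConstraints R)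

≗-by-points : {R S : BRel 2} →
  R (false ∷ false ∷ []) ≡ S (false ∷ false ∷ []) → R (false ∷ true ∷ []) ≡ S (false ∷ true ∷ []) →
  R (true ∷ false ∷ []) ≡ S (true ∷ false ∷ []) → R (true ∷ true ∷ []) ≡ S (true ∷ true ∷ []) →
  R ≗ S
≗-by-points e₀₀ _ _ _ (false ∷ false ∷ []) = e₀₀
≗-by-points _ e₀₁ _ _ (false ∷ true ∷ []) = e₀₁
≗-by-points _ _ e₁₀ _ (true ∷ false ∷ []) = e₁₀
≗-by-points _ _ _ e₁₁ (true ∷ true ∷ []) = e₁₁

table : Bool → Bool → Bool → Bool → BRel 2
table a b c d (false ∷ false ∷ []) = a
table a b c d (false ∷ true ∷ []) = b
table a b c d (true ∷ false ∷ []) = c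
table a b c d (true ∷ true ∷ []) = d

table-of : (R : BRel 2) →
  R ≗ table (R (false ∷ false ∷ [])) (R (false ∷ true ∷ [])) (R (true ∷ false ∷ [])) (R (true ∷ true ∷ []))
table-of R = ≗-by-points refl refl refl refl

PuncturedOrAffine : BRel 2 → Set
PuncturedOrAffine R = (∃₂ λ q₀ q₁ → R ≗ punctured q₀ q₁) ⊎ R ≗ affineHull R

-- The tables with exactly three ones are punctured squares; all others
-- coincide with their affine hull (checked by computation).
table-dichotomy : ∀ a b c d → PuncturedOrAffine (table a b c d)
table-dichotomy false true true true = inj₁ (false , false , ≗-by-points refl refl refl refl)
table-dichotomy true false true true = inj₁ (false , true , ≗-by-points refl refl refl refl)
table-dichotomy true true false true = inj₁ (true , false , ≗-by-points refl refl refl refl)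
table-dichotomy true true true false = inj₁ (true , true , ≗-by-points refl refl refl refl)
table-dichotomy false false false false = inj₂ (≗-by-points refl refl refl refl)
table-dichotomy false false false true = inj₂ (≗-by-points refl refl refl refl)
table-dichotomy false false true false = inj₂ (≗-by-points refl refl refl refl)
table-dichotomy false false true true = inj₂ (≗-by-points refl refl refl refl)
table-dichotomy false true false false = inj₂ (≗-by-points refl refl refl refl)
table-dichotomy false true false true = inj₂ (≗-by-points refl refl refl refl)
table-dichotomy false true true false = inj₂ (≗-by-points refl refl refl refl)
table-dichotomy true false false false = inj₂ (≗-by-points refl refl refl refl)
table-dichotomy true false false true = inj₂ (≗-by-points refl refl refl refl)
table-dichotomy true false true false = inj₂ (≗-by-points refl refl refl refl)
table-dichotomy true true false false = inj₂ (≗-by-points refl refl refl refl)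
table-dichotomy true true true true = inj₂ (≗-by-points refl refl refl refl)

-- The affine hull only looks at the table of R, so the dichotomy transfers.
dichotomy : (R : BRel 2) → PuncturedOrAffine R
dichotomy R with table-dichotomy (R (false ∷ false ∷ [])) (R (false ∷ true ∷ []))
                                 (R (true ∷ false ∷ [])) (R (true ∷ true ∷ []))
... | inj₁ (q₀ , q₁ , T≗P) = inj₁ (q₀ , q₁ , λ v → trans (table-of R v) (T≗P v))
... | inj₂ T≗H = inj₂ (λ v → trans (table-of R v) (T≗H v))

theorem6p2 : (R : BRel 2) → Balanced R ⇔ (¬ ConeInterdefinable R OR2)
theorem6p2 R = mk⇔ balanced⇒not-OR balanced-if-not-OR
  where
  balanced⇒not-OR : Balanced R → ¬ ConeInterdefinable R OR2
  balanced⇒not-OR bal (R-from-OR2 , _) with definable-from-OR2 R-from-OR2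
  ... | q₀ , q₁ , R≗P = punctured-not-balanced q₀ q₁ (balanced-resp R≗P bal)

  balanced-if-not-OR : ¬ ConeInterdefinable R OR2 → Balanced R
  balanced-if-not-OR not-OR with dichotomy R
  ... | inj₁ (q₀ , q₁ , R≗P) =
    ⊥-elim (not-OR (interdefinable-resp {U = OR2} (λ v → sym (R≗P v)) (punctured-interdefinable q₀ q₁)))
  ... | inj₂ R≗H = balanced-resp (λ v → sym (R≗H v)) (affineHull-balanced R)
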